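{- Let $w,v$ be infinite binary words. (1) For all $n\ge1$, $\psi_w(n)=P_{w'}(n)-P_{w''}(n)+1$, where $w'=\mathrm{PNF}_1(w)$ and $w''=\mathrm{PNF}_0(w)$. (2) $\Pi(w)=\Pi(v)$ if and only if $\mathrm{PNF}_0(w)=\mathrm{PNF}_0(v)$ and $\mathrm{PNF}_1(w)=\mathrm{PNF}_1(v)$.
   Context: Binary words are indexed from $1$; $P_w(i)$ is the number of $1$s in the prefix of length $i$ of $w$. For a finite word $u$, its Parikh vector is $pv(u)=(|u|_0,|u|_1)$ (numbers of $0$s and $1$s). $\Pi(w)=\{pv(u): u \text{ a factor of } w\}$, and the abelian complexity is $\psi_w(n)=|\{pv(u): u \text{ a factor of } w,\ |u|=n\}|$. $F^1_w(i)$ (resp. $F^0_w(i)$) is the maximum number of $1$s (resp. $0$s) in a factor of $w$ of length $i$, with $F^a_w(0)=0$. The prefix normal forms are the infinite words $\mathrm{PNF}_1(w)=w'$, $\mathrm{PNF}_0(w)=w''$ with $w'_n=F^1_w(n)-F^1_w(n-1)$ and $w''_n=1-(F^0_w(n)-F^0_w(n-1))$ for $n\ge1$. -}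

module Defs where

open import Data.Bool using (Bool; true; false; not)
open import Data.Nat using (ℕ; zero; suc; _+_; _∸_; _≤_)
open import Data.Product using (_×_; _,_; ∃; ∃-syntax)
open import Data.List using (List; length)
open import Data.List.Membership.Propositional using (_∈_)
open import Data.List.Relation.Unary.Unique.Propositional using (Unique)
open import Function.Bundles using (_⇔_)
open import Relation.Binary.PropositionalEquality using (_≡_)

-- An infinite binary word, 0-indexed internally:
-- (w i) is the letter at (1-based) position i+1 of the paper; true = 1, false = 0.
Word : Set
Word = ℕ → Bool

bit : Bool → ℕ
bit true  = 1
bit false = 0

sumTo : ℕ → (ℕ → ℕ) → ℕ
sumTo zero    f = 0
sumTo (suc n) f = sumTo n f + f n

P : Word → ℕ → ℕ
P w i = sumTo i (λ k → bit (w k))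

ones : Word → ℕ → ℕ → ℕ
ones w i n = sumTo n (λ k → bit (w (i + k)))

zeros : Word → ℕ → ℕ → ℕ
zeros w i n = sumTo n (λ k → bit (not (w (i + k))))

pv : Word → ℕ → ℕ → ℕ × ℕ
pv w i n = (zeros w i n , ones w i n)

Π : Word → ℕ × ℕ → Set
Π w p = ∃[ i ] ∃[ n ] (pv w i n ≡ p)

PVlen : Word → ℕ → ℕ × ℕ → Set
PVlen w n p = ∃[ i ] (pv w i n ≡ p)

HasSize : (ℕ × ℕ → Set) → ℕ → Set
HasSize S m = ∃[ xs ] (Unique xs × (∀ p → (p ∈ xs) ⇔ S p) × length xs ≡ m)

-- ψ_w(n) = m  (abelian complexity, as a relation since it is not computable).
AbelianComplexity : Word → ℕ → ℕ → Set
AbelianComplexity w n m = HasSize (PVlen w n) m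

IsF1 : Word → (ℕ → ℕ) → Set
IsF1 w F = ∀ n → (∃[ i ] (ones w i n ≡ F n)) × (∀ i → ones w i n ≤ F n)

IsF0 : Word → (ℕ → ℕ) → Set
IsF0 w F = ∀ n → (∃[ i ] (zeros w i n ≡ F n)) × (∀ i → zeros w i n ≤ F n)

-- Nat value 0 ↦ 0, otherwise 1 (the differences below are always 0 or 1).
toBit : ℕ → Bool
toBit zero    = false
toBit (suc _) = true

-- PNF_1(w) given F = F^1_w:  w'_{n} = F(n) - F(n-1), n ≥ 1  (0-based: index i = n-1).
PNF₁ : (ℕ → ℕ) → Word
PNF₁ F i = toBit (F (suc i) ∸ F i)

PNF₀ : (ℕ → ℕ) → Word
PNF₀ F i = toBit (1 ∸ (F (suc i) ∸ F i))

_≈w_ : Word → Word → Set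
u ≈w v = ∀ i → u i ≡ v i

-- The counts of 1s in the length-n factors of w change by at most one when the factor slides by one
-- position, so by a discrete intermediate value argument they fill the whole interval between the
-- minimum n ∸ F⁰(n) and the maximum F¹(n).  Since F¹ and F⁰ start at 0 and grow in steps of 0 or 1,
-- PNF₁ records the steps of F¹ and PNF₀ those of n ↦ n ∸ F⁰(n), i.e. P_{w'}(n) = F¹(n) and
-- P_{w''}(n) = n ∸ F⁰(n).  Both parts follow: the length-n Parikh vectors are the (n ∸ k , k) with
-- k in that interval, and Π(w) determines and is determined by the pair (F¹, F⁰).
module Submission where

open import Defs
open import Data.Bool using (true; false; not)
open import Data.Nat
open import Data.Nat.Properties
open import Data.Product
open import Data.Product.Function.NonDependent.Propositional using (_×-⇔_)
open import Data.List using (List; applyUpTo)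
open import Data.List.Properties using (length-applyUpTo)
open import Data.List.Membership.Propositional using (_∈_)
open import Data.List.Membership.Propositional.Properties using (∈-applyUpTo⁺; ∈-applyUpTo⁻)
open import Data.List.Relation.Unary.Unique.Propositional.Properties using (applyUpTo⁺₁)
open import Data.Sum using (inj₁; inj₂)
open import Function.Base using (_∘_)
open import Function.Bundles using (_⇔_; mk⇔; Equivalence)
open import Function.Construct.Composition using (_⇔-∘_)
open import Function.Construct.Identity using (⇔-id)
open import Function.Construct.Symmetry using (⇔-sym)
open import Algebra.Properties.CommutativeSemigroup +-commutativeSemigroup using (interchange)
open import Relation.Binary.PropositionalEquality
open import Relation.Nullary using (¬_; yes; no)
open import Relation.Unary using (Decidable)

sumTo-cong : ∀ n {f g : ℕ → ℕ} → (∀ k → f k ≡ g k) → sumTo n f ≡ sumTo n g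
sumTo-cong zero    f≗g = refl
sumTo-cong (suc n) f≗g = cong₂ _+_ (sumTo-cong n f≗g) (f≗g n)

sumTo-suc : ∀ n (f : ℕ → ℕ) → sumTo (suc n) f ≡ f 0 + sumTo n (f ∘ suc)
sumTo-suc zero    f = +-comm 0 (f 0)
sumTo-suc (suc n) f = begin
  sumTo n f + f n + f (suc n)            ≡⟨ cong (_+ f (suc n)) (sumTo-suc n f) ⟩
  f 0 + sumTo n (f ∘ suc) + f (suc n)    ≡⟨ +-assoc (f 0) _ _ ⟩
  f 0 + (sumTo n (f ∘ suc) + f (suc n))  ∎
  where open ≡-Reasoning

bit≤1 : ∀ b → bit b ≤ 1
bit≤1 true  = s≤s z≤n
bit≤1 false = z≤n

bit-not+bit : ∀ b → bit (not b) + bit b ≡ 1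
bit-not+bit true  = refl
bit-not+bit false = refl

zeros+ones : ∀ w i n → zeros w i n + ones w i n ≡ n
zeros+ones w i zero    = refl
zeros+ones w i (suc n) = begin
  zeros w i n + bit (not (w (i + n))) + (ones w i n + bit (w (i + n)))
    ≡⟨ interchange (zeros w i n) _ (ones w i n) _ ⟩
  zeros w i n + ones w i n + (bit (not (w (i + n))) + bit (w (i + n)))
    ≡⟨ cong₂ _+_ (zeros+ones w i n) (bit-not+bit (w (i + n))) ⟩
  n + 1
    ≡⟨ +-comm n 1 ⟩
  suc n ∎
  where open ≡-Reasoning

ones≡length∸zeros : ∀ w i n → ones w i n ≡ n ∸ zeros w i n
ones≡length∸zeros w i n =
  trans (sym (m+n∸m≡n (zeros w i n) (ones w i n))) (cong (_∸ zeros w i n) (zeros+ones w i n))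

pv≡ : ∀ w i n → pv w i n ≡ (n ∸ ones w i n , ones w i n)
pv≡ w i n = cong (_, ones w i n)
  (trans (sym (m+n∸n≡m (zeros w i n) (ones w i n))) (cong (_∸ ones w i n) (zeros+ones w i n)))

pv⇒length : ∀ w i m v j n → pv w i m ≡ pv v j n → m ≡ n
pv⇒length w i m v j n eq = begin
  m                         ≡⟨ zeros+ones w i m ⟨
  zeros w i m + ones w i m  ≡⟨ cong₂ _+_ (cong proj₁ eq) (cong proj₂ eq) ⟩
  zeros v j n + ones v j n  ≡⟨ zeros+ones v j n ⟩
  n                         ∎
  where open ≡-Reasoning

ones-head : ∀ w i n → ones w i (suc n) ≡ bit (w i) + ones w (suc i) n
ones-head w i n = trans (sumTo-suc n (λ k → bit (w (i + k))))
  (cong₂ _+_ (cong (bit ∘ w) (+-identityʳ i)) (sumTo-cong n (λ k → cong (bit ∘ w) (+-suc i k))))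

ones-slide-≤ : ∀ w i n → ones w (suc i) n ≤ suc (ones w i n)
ones-slide-≤ w i n = begin
  ones w (suc i) n                ≤⟨ m≤n+m _ (bit (w i)) ⟩
  bit (w i) + ones w (suc i) n    ≡⟨ ones-head w i n ⟨
  ones w i n + bit (w (i + n))    ≤⟨ +-monoʳ-≤ (ones w i n) (bit≤1 _) ⟩
  ones w i n + 1                  ≡⟨ +-comm _ 1 ⟩
  suc (ones w i n)                ∎
  where open ≤-Reasoning

ones-slide-≥ : ∀ w i n → ones w i n ≤ suc (ones w (suc i) n)
ones-slide-≥ w i n = begin
  ones w i n                      ≤⟨ m≤m+n _ _ ⟩
  ones w i n + bit (w (i + n))    ≡⟨ ones-head w i n ⟩
  bit (w i) + ones w (suc i) n    ≤⟨ +-monoˡ-≤ _ (bit≤1 _) ⟩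
  suc (ones w (suc i) n)          ∎
  where open ≤-Reasoning

-- Discrete intermediate value theorem

walk : {A B : ℕ → Set} → Decidable B → (∀ i → A i → ¬ B i → A (suc i)) →
       ∀ d i → A i → B (d + i) → ∃[ k ] (A k × B k)
walk B? step zero    i a b = i , a , b
walk {B = B} B? step (suc d) i a b with B? i
... | yes bᵢ = i , a , bᵢ
... | no ¬bᵢ = walk B? step d (suc i) (step i a ¬bᵢ) (subst B (sym (+-suc d i)) b)

walk-≤ : {A B : ℕ → Set} → Decidable B → (∀ i → A i → ¬ B i → A (suc i)) →
         ∀ {i j} → i ≤ j → A i → B j → ∃[ k ] (A k × B k)
walk-≤ {B = B} B? step {i} {j} i≤j a b = walk B? step (j ∸ i) i a (subst B (sym (m∸n+n≡m i≤j)) b)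

module _ (g : ℕ → ℕ) (up : ∀ i → g (suc i) ≤ suc (g i)) (down : ∀ i → g i ≤ suc (g (suc i))) where

  intermediate-value : ∀ {c} i j → g i ≤ c → c ≤ g j → ∃[ k ] g k ≡ c
  intermediate-value {c} i j gᵢ≤c c≤gⱼ with ≤-total i j
  ... | inj₁ i≤j =
    let k , gₖ≤c , c≤gₖ = walk-≤ (λ k → c ≤? g k) rise i≤j gᵢ≤c c≤gⱼ in k , ≤-antisym gₖ≤c c≤gₖ
    where
    rise : ∀ k → g k ≤ c → ¬ c ≤ g k → g (suc k) ≤ c
    rise k _ c≰gₖ = ≤-trans (up k) (≰⇒> c≰gₖ)
  ... | inj₂ j≤i =
    let k , c≤gₖ , gₖ≤c = walk-≤ (λ k → g k ≤? c) fall j≤i c≤gⱼ gᵢ≤c in k , ≤-antisym gₖ≤c c≤gₖ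
    where
    fall : ∀ k → c ≤ g k → ¬ g k ≤ c → c ≤ g (suc k)
    fall k _ gₖ≰c = ≤-pred (≤-trans (≰⇒> gₖ≰c) (down k))

record UnitSteps (F : ℕ → ℕ) : Set where
  field
    start : F 0 ≡ 0
    mono  : ∀ n → F n ≤ F (suc n)
    step  : ∀ n → F (suc n) ≤ suc (F n)

IsF1⇒UnitSteps : ∀ w {F} → IsF1 w F → UnitSteps F
IsF1⇒UnitSteps w {F} isF = record { start = start ; mono = mono ; step = step }
  where
  start : F 0 ≡ 0
  start = let i , eq = proj₁ (isF 0) in sym eq
  mono : ∀ n → F n ≤ F (suc n)
  mono n = let i , eq = proj₁ (isF n) in
    subst (_≤ F (suc n)) eq (≤-trans (m≤m+n _ _) (proj₂ (isF (suc n)) i))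
  step : ∀ n → F (suc n) ≤ suc (F n)
  step n = let i , eq = proj₁ (isF (suc n)) in begin
    F (suc n)                    ≡⟨ eq ⟨
    ones w i n + bit (w (i + n)) ≤⟨ +-mono-≤ (proj₂ (isF n) i) (bit≤1 _) ⟩
    F n + 1                      ≡⟨ +-comm _ 1 ⟩
    suc (F n)                    ∎
    where open ≤-Reasoning

-- zeros w = ones (not ∘ w) definitionally, so IsF0 w is IsF1 (not ∘ w).
IsF0⇒UnitSteps : ∀ w {F} → IsF0 w F → UnitSteps F
IsF0⇒UnitSteps w = IsF1⇒UnitSteps (not ∘ w)

bit-toBit-step : ∀ x y → x ≤ y → y ≤ suc x → bit (toBit (y ∸ x)) + x ≡ y
bit-toBit-step zero    zero          _       _       = refl
bit-toBit-step zero    (suc zero)    _       _       = refl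
bit-toBit-step zero    (suc (suc y)) _       (s≤s ())
bit-toBit-step (suc x) (suc y)       (s≤s p) (s≤s q) = trans (+-suc _ x) (cong suc (bit-toBit-step x y p q))

bit-toBit-co-step : ∀ x y → x ≤ y → y ≤ suc x → bit (toBit (1 ∸ (y ∸ x))) + y ≡ suc x
bit-toBit-co-step zero    zero          _       _       = refl
bit-toBit-co-step zero    (suc zero)    _       _       = refl
bit-toBit-co-step zero    (suc (suc y)) _       (s≤s ())
bit-toBit-co-step (suc x) (suc y)       (s≤s p) (s≤s q) = trans (+-suc _ y) (cong suc (bit-toBit-co-step x y p q))

P-cong : ∀ {u v} → u ≈w v → ∀ n → P u n ≡ P v n
P-cong u≈v n = sumTo-cong n (λ k → cong bit (u≈v k))

module _ {F} (F-steps : UnitSteps F) where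
  open UnitSteps F-steps

  P-PNF₁ : ∀ n → P (PNF₁ F) n ≡ F n
  P-PNF₁ zero    = sym start
  P-PNF₁ (suc n) = begin
    P (PNF₁ F) n + bit (PNF₁ F n)  ≡⟨ cong (_+ bit (PNF₁ F n)) (P-PNF₁ n) ⟩
    F n + bit (PNF₁ F n)           ≡⟨ +-comm (F n) _ ⟩
    bit (PNF₁ F n) + F n           ≡⟨ bit-toBit-step (F n) (F (suc n)) (mono n) (step n) ⟩
    F (suc n)                      ∎
    where open ≡-Reasoning

  P-PNF₀+F : ∀ n → P (PNF₀ F) n + F n ≡ n
  P-PNF₀+F zero    = cong (0 +_) start
  P-PNF₀+F (suc n) = begin
    P (PNF₀ F) n + bit (PNF₀ F n) + F (suc n)    ≡⟨ +-assoc (P (PNF₀ F) n) _ _ ⟩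
    P (PNF₀ F) n + (bit (PNF₀ F n) + F (suc n))
      ≡⟨ cong (P (PNF₀ F) n +_) (bit-toBit-co-step (F n) (F (suc n)) (mono n) (step n)) ⟩
    P (PNF₀ F) n + suc (F n)                     ≡⟨ +-suc _ (F n) ⟩
    suc (P (PNF₀ F) n + F n)                     ≡⟨ cong suc (P-PNF₀+F n) ⟩
    suc n                                        ∎
    where open ≡-Reasoning

  P-PNF₀ : ∀ n → P (PNF₀ F) n ≡ n ∸ F n
  P-PNF₀ n = trans (sym (m+n∸n≡m _ (F n))) (cong (_∸ F n) (P-PNF₀+F n))

  F≡∸P-PNF₀ : ∀ n → F n ≡ n ∸ P (PNF₀ F) n
  F≡∸P-PNF₀ n = trans (sym (m+n∸m≡n (P (PNF₀ F) n) (F n))) (cong (_∸ P (PNF₀ F) n) (P-PNF₀+F n))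

module _ {F G} (F-steps : UnitSteps F) (G-steps : UnitSteps G) where

  PNF₁-≈w⇔ : PNF₁ F ≈w PNF₁ G ⇔ (∀ n → F n ≡ G n)
  PNF₁-≈w⇔ = mk⇔
    (λ eq n → trans (sym (P-PNF₁ F-steps n)) (trans (P-cong eq n) (P-PNF₁ G-steps n)))
    (λ eq i → cong toBit (cong₂ _∸_ (eq (suc i)) (eq i)))

  PNF₀-≈w⇔ : PNF₀ F ≈w PNF₀ G ⇔ (∀ n → F n ≡ G n)
  PNF₀-≈w⇔ = mk⇔
    (λ eq n → trans (F≡∸P-PNF₀ F-steps n)
                (trans (cong (n ∸_) (P-cong eq n)) (sym (F≡∸P-PNF₀ G-steps n))))
    (λ eq i → cong (λ d → toBit (1 ∸ d)) (cong₂ _∸_ (eq (suc i)) (eq i)))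

ParikhInterval : ℕ → ℕ → ℕ → ℕ × ℕ → Set
ParikhInterval n lo hi p = ∃[ k ] ((lo ≤ k × k ≤ hi) × p ≡ (n ∸ k , k))

parikhRange : ℕ → ℕ → ℕ → List (ℕ × ℕ)
parikhRange n lo hi = applyUpTo (λ j → (n ∸ (j + lo) , j + lo)) (hi ∸ lo + 1)

module _ (n : ℕ) {lo hi : ℕ} (lo≤hi : lo ≤ hi) where

  ∈-parikhRange : ∀ p → p ∈ parikhRange n lo hi ⇔ ParikhInterval n lo hi p
  ∈-parikhRange p = mk⇔ to from
    where
    to : p ∈ parikhRange n lo hi → ParikhInterval n lo hi p
    to p∈ = let j , j<len , eq = ∈-applyUpTo⁻ _ p∈ in
      j + lo , (m≤n+m lo j , m≤o∸n⇒m+n≤o j lo≤hi (m<1+n⇒m≤n (subst (j <_) (+-comm _ 1) j<len))) , eq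
    from : ParikhInterval n lo hi p → p ∈ parikhRange n lo hi
    from (k , (lo≤k , k≤hi) , refl) =
      subst (λ k′ → (n ∸ k′ , k′) ∈ parikhRange n lo hi) (m∸n+n≡m lo≤k)
        (∈-applyUpTo⁺ _ (subst (k ∸ lo <_) (+-comm 1 _) (s≤s (∸-monoˡ-≤ lo k≤hi))))

  HasSize-parikhRange : HasSize (_∈ parikhRange n lo hi) (hi ∸ lo + 1)
  HasSize-parikhRange =
    parikhRange n lo hi ,
    applyUpTo⁺₁ _ _ (λ i<j _ eq → <⇒≢ i<j (+-cancelʳ-≡ _ _ _ (cong proj₂ eq))) ,
    (λ _ → ⇔-id _) ,
    length-applyUpTo _ _

HasSize-⇔ : ∀ {S T m} → (∀ p → S p ⇔ T p) → HasSize S m → HasSize T m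
HasSize-⇔ S⇔T (xs , unique , ∈xs⇔S , len) =
  xs , unique , (λ p → S⇔T p ⇔-∘ ∈xs⇔S p) , len

module _ (w : Word) {F₁ F₀} (isF₁ : IsF1 w F₁) (isF₀ : IsF0 w F₀) where

  ones-lower : ∀ i n → n ∸ F₀ n ≤ ones w i n
  ones-lower i n =
    subst (n ∸ F₀ n ≤_) (sym (ones≡length∸zeros w i n)) (∸-monoʳ-≤ n (proj₂ (isF₀ n) i))

  ones-range : ∀ n k → (∃[ i ] ones w i n ≡ k) ⇔ (n ∸ F₀ n ≤ k × k ≤ F₁ n)
  ones-range n k = mk⇔
    (λ { (i , refl) → ones-lower i n , proj₂ (isF₁ n) i })
    (λ (lo≤k , k≤hi) →
      let a , zerosₐ≡F₀ = proj₁ (isF₀ n)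
          b , onesᵦ≡F₁ = proj₁ (isF₁ n)
          onesₐ≡lo = trans (ones≡length∸zeros w a n) (cong (n ∸_) zerosₐ≡F₀)
      in intermediate-value (λ i → ones w i n) (λ i → ones-slide-≤ w i n) (λ i → ones-slide-≥ w i n)
           a b (subst (_≤ k) (sym onesₐ≡lo) lo≤k) (subst (k ≤_) (sym onesᵦ≡F₁) k≤hi))

  F-lower≤upper : ∀ n → n ∸ F₀ n ≤ F₁ n
  F-lower≤upper n = ≤-trans (ones-lower 0 n) (proj₂ (isF₁ n) 0)

  PVlen⇔parikhRange : ∀ n p → PVlen w n p ⇔ p ∈ parikhRange n (n ∸ F₀ n) (F₁ n)
  PVlen⇔parikhRange n p = ⇔-sym (∈-parikhRange n (F-lower≤upper n) p) ⇔-∘ mk⇔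
    (λ (i , eq) → ones w i n , Equivalence.to (ones-range n _) (i , refl) , trans (sym eq) (pv≡ w i n))
    (λ (k , range , eq) → let i , onesᵢ≡k = Equivalence.from (ones-range n k) range in
      i , trans (pv≡ w i n) (trans (cong (λ k → (n ∸ k , k)) onesᵢ≡k) (sym eq)))

  abelian-complexity : ∀ n → AbelianComplexity w n (P (PNF₁ F₁) n ∸ P (PNF₀ F₀) n + 1)
  abelian-complexity n =
    subst (AbelianComplexity w n)
      (cong₂ (λ hi lo → hi ∸ lo + 1) (sym (P-PNF₁ F₁-steps n)) (sym (P-PNF₀ F₀-steps n)))
      (HasSize-⇔ (λ p → ⇔-sym (PVlen⇔parikhRange n p)) (HasSize-parikhRange n (F-lower≤upper n)))
    where
    F₁-steps : UnitSteps F₁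
    F₁-steps = IsF1⇒UnitSteps w isF₁
    F₀-steps : UnitSteps F₀
    F₀-steps = IsF0⇒UnitSteps w isF₀

Π⊆⇒PVlen⊆ : ∀ w v → (∀ p → Π w p → Π v p) → ∀ n p → PVlen w n p → PVlen v n p
Π⊆⇒PVlen⊆ w v Π⊆ n _ (i , refl) =
  let j , m , eq = Π⊆ (pv w i n) (i , n , refl) in
  j , subst (λ m → pv v j m ≡ pv w i n) (pv⇒length v j m w i n eq) eq

PVlen⊆⇒Π⊆ : ∀ w v → (∀ n p → PVlen w n p → PVlen v n p) → ∀ p → Π w p → Π v p
PVlen⊆⇒Π⊆ w v PVlen⊆ p (i , n , eq) = let j , eq′ = PVlen⊆ n p (i , eq) in j , n , eq′

module _ (w v : Word) n (PVlen⊆ : ∀ p → PVlen w n p → PVlen v n p) where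

  F1-mono : ∀ {F G} → IsF1 w F → IsF1 v G → F n ≤ G n
  F1-mono {G = G} isF isG =
    let i , eq = proj₁ (isF n) ; j , eq′ = PVlen⊆ _ (i , refl) in
    subst (_≤ G n) (trans (cong proj₂ eq′) eq) (proj₂ (isG n) j)

  F0-mono : ∀ {F G} → IsF0 w F → IsF0 v G → F n ≤ G n
  F0-mono {G = G} isF isG =
    let i , eq = proj₁ (isF n) ; j , eq′ = PVlen⊆ _ (i , refl) in
    subst (_≤ G n) (trans (cong proj₁ eq′) eq) (proj₂ (isG n) j)

F-equal⇒PVlen⊆ : ∀ w v {F₁w F₀w F₁v F₀v} → IsF1 w F₁w → IsF0 w F₀w → IsF1 v F₁v → IsF0 v F₀v →
                 (∀ n → F₀w n ≡ F₀v n) → (∀ n → F₁w n ≡ F₁v n) → ∀ n p → PVlen w n p → PVlen v n p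
F-equal⇒PVlen⊆ w v isF₁w isF₀w isF₁v isF₀v F₀≗ F₁≗ n p =
  Equivalence.from (PVlen⇔parikhRange v isF₁v isF₀v n p)
  ∘ subst (p ∈_) (cong₂ (λ F₀ F₁ → parikhRange n (n ∸ F₀) F₁) (F₀≗ n) (F₁≗ n))
  ∘ Equivalence.to (PVlen⇔parikhRange w isF₁w isF₀w n p)

module _ (w v : Word) {F₁w F₀w F₁v F₀v}
         (isF₁w : IsF1 w F₁w) (isF₀w : IsF0 w F₀w) (isF₁v : IsF1 v F₁v) (isF₀v : IsF0 v F₀v) where

  Π-equal⇔F-equal : (∀ p → Π w p ⇔ Π v p) ⇔ ((∀ n → F₀w n ≡ F₀v n) × (∀ n → F₁w n ≡ F₁v n))
  Π-equal⇔F-equal = mk⇔ to from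
    where
    to : (∀ p → Π w p ⇔ Π v p) → (∀ n → F₀w n ≡ F₀v n) × (∀ n → F₁w n ≡ F₁v n)
    to Π≡ = (λ n → ≤-antisym (F0-mono w v n (w⊆v n) isF₀w isF₀v) (F0-mono v w n (v⊆w n) isF₀v isF₀w))
          , (λ n → ≤-antisym (F1-mono w v n (w⊆v n) isF₁w isF₁v) (F1-mono v w n (v⊆w n) isF₁v isF₁w))
      where
      w⊆v : ∀ n p → PVlen w n p → PVlen v n p
      w⊆v = Π⊆⇒PVlen⊆ w v (Equivalence.to ∘ Π≡)
      v⊆w : ∀ n p → PVlen v n p → PVlen w n p
      v⊆w = Π⊆⇒PVlen⊆ v w (Equivalence.from ∘ Π≡)
    from : (∀ n → F₀w n ≡ F₀v n) × (∀ n → F₁w n ≡ F₁v n) → ∀ p → Π w p ⇔ Π v p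
    from (F₀≗ , F₁≗) p = mk⇔
      (PVlen⊆⇒Π⊆ w v (F-equal⇒PVlen⊆ w v isF₁w isF₀w isF₁v isF₀v F₀≗ F₁≗) p)
      (PVlen⊆⇒Π⊆ v w (F-equal⇒PVlen⊆ v w isF₁v isF₀v isF₁w isF₀w (sym ∘ F₀≗) (sym ∘ F₁≗)) p)

theorem3 : (w v : Word) (F1w F0w F1v F0v : ℕ → ℕ)
    → IsF1 w F1w → IsF0 w F0w → IsF1 v F1v → IsF0 v F0v
    → ((n : ℕ) → AbelianComplexity w (suc n)
                   (P (PNF₁ F1w) (suc n) ∸ P (PNF₀ F0w) (suc n) + 1))
      × ((∀ p → Π w p ⇔ Π v p)
          ⇔ ((PNF₀ F0w ≈w PNF₀ F0v) × (PNF₁ F1w ≈w PNF₁ F1v)))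
theorem3 w v F1w F0w F1v F0v isF₁w isF₀w isF₁v isF₀v =
  abelian-complexity w isF₁w isF₀w ∘ suc ,
  ⇔-sym (PNF₀-≈w⇔ (IsF0⇒UnitSteps w isF₀w) (IsF0⇒UnitSteps v isF₀v)
         ×-⇔ PNF₁-≈w⇔ (IsF1⇒UnitSteps w isF₁w) (IsF1⇒UnitSteps v isF₁v))
  ⇔-∘ Π-equal⇔F-equal w v isF₁w isF₀w isF₁v isF₀v
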